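{- Let $n\ge 1$ and $k\in\{1,2\}$. The number of inversion sequences of length $n$ that avoid $120$, $201$, and $1010$ and have exactly $k$ layers equals the Eulerian number $E(n,k)$, the number of permutations of $\{1,\dots,n\}$ with exactly $k-1$ descents.
   Context: An inversion sequence of length $n$ is a word $e=e_1\cdots e_n$ of integers with $0\le e_i\le i-1$. A word $w$ contains a pattern $p=p_1\cdots p_k$ if $w$ has a subsequence $w_{\alpha_1}\cdots w_{\alpha_k}$ ($\alpha_1<\cdots<\alpha_k$) with $w_{\alpha_i}<w_{\alpha_j}$ iff $p_i<p_j$ and $w_{\alpha_i}=w_{\alpha_j}$ iff $p_i=p_j$; otherwise it avoids $p$. The layers of a word are its maximal contiguous weakly decreasing factors; thus the number of layers equals one plus the number of indices $i$ with $w_i<w_{i+1}$. (Inversion sequences avoiding $120,201,1010$ are exactly those sortable by a pop stack, and the number of layers is the number of pops needed.) A descent of a permutation $\pi$ is an index $i$ with $\pi_i>\pi_{i+1}$. -}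

module Defs where

open import Data.Nat using (ℕ; zero; suc; _+_; _<_; _≤_; _<ᵇ_)
open import Data.Bool using (if_then_else_)
open import Data.Fin using (Fin; toℕ) renaming (_<_ to _<ꟳ_)
open import Data.Vec using (Vec; []; _∷_; lookup; toList; map)
open import Data.List using (List; []; _∷_)
open import Data.Product using (Σ; _×_; ∃)
open import Relation.Nullary using (¬_)
open import Relation.Binary.PropositionalEquality using (_≡_)
open import Function.Bundles using (_⇔_)

-- A word of length n is a Vec ℕ n.
-- Inversion sequence: 0 ≤ e_i ≤ i-1 (1-based), i.e. e[i] ≤ i (0-based Fin index).
IsInvSeq : ∀ {n} → Vec ℕ n → Set
IsInvSeq {n} e = ∀ (i : Fin n) → lookup e i ≤ toℕ i

Contains : ∀ {n m} → Vec ℕ n → Vec ℕ m → Set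
Contains {n} {m} w p =
  Σ (Fin m → Fin n) λ α →
    (∀ i j → i <ꟳ j → α i <ꟳ α j) ×
    (∀ i j → (lookup w (α i) < lookup w (α j) ⇔ lookup p i < lookup p j)
           × (lookup w (α i) ≡ lookup w (α j) ⇔ lookup p i ≡ lookup p j))

Avoids : ∀ {n m} → Vec ℕ n → Vec ℕ m → Set
Avoids w p = ¬ Contains w p

p120 : Vec ℕ 3
p120 = 1 ∷ 2 ∷ 0 ∷ []

p201 : Vec ℕ 3
p201 = 2 ∷ 0 ∷ 1 ∷ []

p1010 : Vec ℕ 4
p1010 = 1 ∷ 0 ∷ 1 ∷ 0 ∷ []

ascentsL : List ℕ → ℕ
ascentsL []            = 0
ascentsL (x ∷ [])      = 0
ascentsL (x ∷ y ∷ r)   = (if x <ᵇ y then 1 else 0) + ascentsL (y ∷ r)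

descentsL : List ℕ → ℕ
descentsL []           = 0
descentsL (x ∷ [])     = 0
descentsL (x ∷ y ∷ r)  = (if y <ᵇ x then 1 else 0) + descentsL (y ∷ r)

-- number of layers (maximal weakly decreasing factors) = 1 + #ascents
layers : ∀ {n} → Vec ℕ n → ℕ
layers w = suc (ascentsL (toList w))

record PopInvSeq (n k : ℕ) : Set where
  constructor mkPopInvSeq
  field
    seq       : Vec ℕ n
    .isInv    : IsInvSeq seq
    .av120    : Avoids seq p120
    .av201    : Avoids seq p201
    .av1010   : Avoids seq p1010
    .nLayers  : layers seq ≡ k

-- A permutation of {1..n} (0-based: of Fin n) in one-line notation:
-- an injective word π : Vec (Fin n) n.
descents : ∀ {n} → Vec (Fin n) n → ℕ
descents π = descentsL (toList (map toℕ π))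

-- Permutations of [n] with exactly d descents (these are counted by E(n, d+1)).
record PermWithDescents (n d : ℕ) : Set where
  constructor mkPerm
  field
    perm     : Vec (Fin n) n
    .inj     : ∀ i j → lookup perm i ≡ lookup perm j → i ≡ j
    .nDes    : descents perm ≡ d

{-# OPTIONS --safe #-}

-- An inversion sequence starts with 0, so one with at most one ascent is a run of zeros
-- followed by a weakly decreasing word, and each of its rises e_i < e_j starts inside the
-- zero run. Each of 120, 201 and 1010 has an entry, at or before the start of a rise, that
-- exceeds some other entry; so for k ≤ 2 the avoidance conditions hold automatically.
-- It remains to match inversion sequences with d ascents and permutations with d descents,
-- by the classical bijection e_i = #{j < i : π_j > π_i}: if π_i > π_{i+1}, every earlier
-- entry above π_i is also above π_{i+1} and so is π_i, whence e_i < e_{i+1}; if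
-- π_i < π_{i+1}, then e_{i+1} ≤ e_i. Reading e from the right, e_n fixes π_n = n - e_n, and
-- e_1 … e_{n-1} is the inversion sequence of π_1 … π_{n-1} with the value π_n punched out.

module Submission where

open import Defs
open import Data.Bool using (Bool; true; false; if_then_else_)
open import Data.Empty using (⊥-elim; ⊥-elim-irr)
open import Data.Fin as Fin
  using (Fin; zero; suc; toℕ; fromℕ; fromℕ<; inject₁; opposite; punchIn; punchOut; #_)
import Data.Fin.Properties as Finₚ
open import Data.List as List using ([]; _∷_; _∷ʳ_)
import Data.List.Properties as Listₚ
open import Data.Nat
  using (ℕ; zero; suc; _+_; _∸_; _<_; _≤_; _<ᵇ_; z≤n; s≤s; z<s; s<s; s≤s⁻¹; s<s⁻¹)
open import Data.Nat.Properties
open import Data.Product using (_×_; _,_; proj₁; proj₂)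
open import Data.Sum using (_⊎_; inj₁; inj₂)
open import Data.Vec as Vec using (Vec; []; _∷_; lookup; map; reverse; toList)
open import Data.Vec.Properties
  using (lookup-map; map-reverse; toList-reverse; reverse-∷; reverse-involutive)
open import Function using (_∘_)
open import Function.Bundles using (_↔_; _⇔_; mk⇔; mk↔ₛ′; Equivalence)
open import Function.Construct.Composition using (_↔-∘_; _⇔-∘_)
open import Relation.Binary.PropositionalEquality
open import Relation.Nullary using (Dec)
open import Relation.Nullary.Decidable using (recompute)
open import Relation.Nullary.Reflects using (ofⁿ; det; fromEquivalence)

indicator : Bool → ℕ
indicator b = if b then 1 else 0

<ᵇ-cong : ∀ {m n o p} → m < n ⇔ o < p → (m <ᵇ n) ≡ (o <ᵇ p)
<ᵇ-cong {m} {n} {o} {p} m<n⇔o<p = det (<ᵇ-reflects-< m n)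
  (fromEquivalence (Equivalence.from m<n⇔o<p ∘ <ᵇ⇒< o p) (<⇒<ᵇ ∘ Equivalence.to m<n⇔o<p))

descentsL-∷ʳ : ∀ xs y x → descentsL (xs ∷ʳ y ∷ʳ x) ≡ descentsL (xs ∷ʳ y) + indicator (x <ᵇ y)
descentsL-∷ʳ []           y x = +-comm _ 0
descentsL-∷ʳ (a ∷ [])     y x =
  trans (cong (indicator (y <ᵇ a) +_) (+-identityʳ _)) (sym (+-assoc (indicator (y <ᵇ a)) 0 _))
descentsL-∷ʳ (a ∷ b ∷ xs) y x = begin
  indicator (b <ᵇ a) + descentsL (b ∷ xs ∷ʳ y ∷ʳ x)
    ≡⟨ cong (indicator (b <ᵇ a) +_) (descentsL-∷ʳ (b ∷ xs) y x) ⟩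
  indicator (b <ᵇ a) + (descentsL (b ∷ xs ∷ʳ y) + indicator (x <ᵇ y))
    ≡⟨ +-assoc (indicator (b <ᵇ a)) _ _ ⟨
  descentsL (a ∷ b ∷ xs ∷ʳ y) + indicator (x <ᵇ y) ∎
  where open ≡-Reasoning

descentsL-reverse-∷ʳ : ∀ l a → descentsL (List.reverse l ∷ʳ a) ≡ ascentsL (a ∷ l)
descentsL-reverse-∷ʳ []      a = refl
descentsL-reverse-∷ʳ (b ∷ l) a = begin
  descentsL (List.reverse (b ∷ l) ∷ʳ a)
    ≡⟨ cong (λ xs → descentsL (xs ∷ʳ a)) (Listₚ.unfold-reverse b l) ⟩
  descentsL (List.reverse l ∷ʳ b ∷ʳ a)
    ≡⟨ descentsL-∷ʳ (List.reverse l) b a ⟩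
  descentsL (List.reverse l ∷ʳ b) + indicator (a <ᵇ b)
    ≡⟨ cong (_+ _) (descentsL-reverse-∷ʳ l b) ⟩
  ascentsL (b ∷ l) + indicator (a <ᵇ b)
    ≡⟨ +-comm (ascentsL (b ∷ l)) _ ⟩
  ascentsL (a ∷ b ∷ l) ∎
  where open ≡-Reasoning

descentsL-reverse : ∀ l → descentsL (List.reverse l) ≡ ascentsL l
descentsL-reverse []      = refl
descentsL-reverse (a ∷ l) =
  trans (cong descentsL (Listₚ.unfold-reverse a l)) (descentsL-reverse-∷ʳ l a)

ascentsL-reverse : ∀ l → ascentsL (List.reverse l) ≡ descentsL l
ascentsL-reverse l =
  trans (sym (descentsL-reverse (List.reverse l))) (cong descentsL (Listₚ.reverse-involutive l))

ascents : ∀ {m k} → Vec (Fin m) k → ℕ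
ascents π = ascentsL (toList (map toℕ π))

descentsL-reverseᵛ : ∀ {k} (xs : Vec ℕ k) → descentsL (toList (reverse xs)) ≡ ascentsL (toList xs)
descentsL-reverseᵛ xs = trans (cong descentsL (toList-reverse xs)) (descentsL-reverse (toList xs))

ascentsL-reverseᵛ : ∀ {k} (xs : Vec ℕ k) → ascentsL (toList (reverse xs)) ≡ descentsL (toList xs)
ascentsL-reverseᵛ xs = trans (cong ascentsL (toList-reverse xs)) (ascentsL-reverse (toList xs))

descents-reverse : ∀ {n} (π : Vec (Fin n) n) → descents (reverse π) ≡ ascents π
descents-reverse π =
  trans (cong (descentsL ∘ toList) (map-reverse toℕ π)) (descentsL-reverseᵛ (map toℕ π))

ascents-map : ∀ {a b k} {f : Fin a → Fin b} → (∀ {x y} → f x Fin.< f y ⇔ x Fin.< y) →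
              (xs : Vec (Fin a) k) → ascents (map f xs) ≡ ascents xs
ascents-map f-<⇔ []           = refl
ascents-map f-<⇔ (x ∷ [])     = refl
ascents-map f-<⇔ (x ∷ y ∷ xs) =
  cong₂ _+_ (cong indicator (<ᵇ-cong f-<⇔)) (ascents-map f-<⇔ (y ∷ xs))

punchIn-<⇔ : ∀ {n} (i : Fin (suc n)) {x y : Fin n} → punchIn i x Fin.< punchIn i y ⇔ x Fin.< y
punchIn-<⇔ i {x} {y} = mk⇔
  (λ ix<iy → ≰⇒> (<⇒≱ ix<iy ∘ Finₚ.punchIn-mono-≤ i y x))
  (λ x<y → ≰⇒> (<⇒≱ x<y ∘ Finₚ.punchIn-cancel-≤ i y x))

<punchIn⇔≤ : ∀ {n} (i : Fin (suc n)) (j : Fin n) → i Fin.< punchIn i j ⇔ i Fin.≤ j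
<punchIn⇔≤ zero    j       = mk⇔ (λ _ → z≤n) (λ _ → z<s)
<punchIn⇔≤ (suc i) zero    = mk⇔ (λ ()) (λ ())
<punchIn⇔≤ (suc i) (suc j) = mk⇔ (s≤s ∘ to ∘ s<s⁻¹) (s<s ∘ from ∘ s≤s⁻¹)
  where open Equivalence (<punchIn⇔≤ i j)

∸-≤-∸⇔ : ∀ {m a b} → b ≤ m → m ∸ a ≤ m ∸ b ⇔ b ≤ a
∸-≤-∸⇔ {m} b≤m = mk⇔
  (λ m∸a≤m∸b → ≮⇒≥ (λ a<b → <⇒≱ (∸-monoʳ-< a<b b≤m) m∸a≤m∸b))
  (∸-monoʳ-≤ m)

Distinct : ∀ {m k} → Vec (Fin m) k → Set
Distinct xs = ∀ i j → lookup xs i ≡ lookup xs j → i ≡ j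

module _ {m k : ℕ} where

  Distinct-∷ : ∀ {x} {xs : Vec (Fin m) k} →
               (∀ i → lookup xs i ≢ x) → Distinct xs → Distinct (x ∷ xs)
  Distinct-∷ x∉xs _ zero    zero    _ = refl
  Distinct-∷ x∉xs _ zero    (suc j) x≡xⱼ = ⊥-elim (x∉xs j (sym x≡xⱼ))
  Distinct-∷ x∉xs _ (suc i) zero    xᵢ≡x = ⊥-elim (x∉xs i xᵢ≡x)
  Distinct-∷ _    d (suc i) (suc j) xᵢ≡xⱼ = cong suc (d i j xᵢ≡xⱼ)

  Distinct-head : ∀ {x} {xs : Vec (Fin m) k} → Distinct (x ∷ xs) → ∀ i → lookup xs i ≢ x
  Distinct-head d i xᵢ≡x with d (suc i) zero xᵢ≡x
  ... | ()

  Distinct-tail : ∀ {x} {xs : Vec (Fin m) k} → Distinct (x ∷ xs) → Distinct xs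
  Distinct-tail d i j xᵢ≡xⱼ = Finₚ.suc-injective (d (suc i) (suc j) xᵢ≡xⱼ)

  Distinct-map⁺ : ∀ {m′} {f : Fin m → Fin m′} {xs : Vec (Fin m) k} →
                  (∀ {x y} → f x ≡ f y → x ≡ y) → Distinct xs → Distinct (map f xs)
  Distinct-map⁺ {f = f} {xs} f-inj d i j fxᵢ≡fxⱼ =
    d i j (f-inj (trans (sym (lookup-map i f xs)) (trans fxᵢ≡fxⱼ (lookup-map j f xs))))

  Distinct-map⁻ : ∀ {m′} {f : Fin m → Fin m′} {xs : Vec (Fin m) k} →
                  Distinct (map f xs) → Distinct xs
  Distinct-map⁻ {f = f} {xs} d i j xᵢ≡xⱼ =
    d i j (trans (lookup-map i f xs) (trans (cong f xᵢ≡xⱼ) (sym (lookup-map j f xs))))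

punchOutAll : ∀ {m k} (v : Fin (suc m)) (ws : Vec (Fin (suc m)) k) → .(∀ i → lookup ws i ≢ v) →
              Vec (Fin m) k
punchOutAll v []       _    = []
punchOutAll v (w ∷ ws) v∉ws =
  punchOut (λ v≡w → ⊥-elim-irr (v∉ws zero (sym v≡w))) ∷ punchOutAll v ws (v∉ws ∘ suc)

map-punchIn-punchOutAll : ∀ {m k} (v : Fin (suc m)) (ws : Vec (Fin (suc m)) k) .v∉ws →
                          map (punchIn v) (punchOutAll v ws v∉ws) ≡ ws
map-punchIn-punchOutAll v []       _    = refl
map-punchIn-punchOutAll v (w ∷ ws) v∉ws =
  cong₂ _∷_ (Finₚ.punchIn-punchOut _) (map-punchIn-punchOutAll v ws (v∉ws ∘ suc))

punchOutAll-map-punchIn : ∀ {m k} (v : Fin (suc m)) (xs : Vec (Fin m) k) .v∉ws →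
                          punchOutAll v (map (punchIn v) xs) v∉ws ≡ xs
punchOutAll-map-punchIn v []       _    = refl
punchOutAll-map-punchIn v (x ∷ xs) v∉ws =
  cong₂ _∷_ (trans (Finₚ.punchOut-cong v refl) (Finₚ.punchOut-punchIn v))
            (punchOutAll-map-punchIn v xs (v∉ws ∘ suc))

punchOutAll-distinct : ∀ {m k} (v : Fin (suc m)) (ws : Vec (Fin (suc m)) k) .v∉ws →
                       Distinct ws → Distinct (punchOutAll v ws v∉ws)
punchOutAll-distinct v ws v∉ws d =
  Distinct-map⁻ {f = punchIn v} {punchOutAll v ws v∉ws}
    (subst Distinct (sym (map-punchIn-punchOutAll v ws v∉ws)) d)

IsCode : ∀ {m} → Vec ℕ m → Set
IsCode {m} c = ∀ i → lookup c i ≤ m ∸ suc (toℕ i)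

fromℕ∸ : ∀ m → ℕ → Fin (suc m)
fromℕ∸ m c = fromℕ< (s≤s (m∸n≤m m c))

toℕ-fromℕ∸ : ∀ m c → toℕ (fromℕ∸ m c) ≡ m ∸ c
toℕ-fromℕ∸ m c = Finₚ.toℕ-fromℕ< (s≤s (m∸n≤m m c))

-- The entry c_i of the code of π is the number of later entries of π exceeding π_i.
decode : ∀ m → Vec ℕ m → Vec (Fin m) m
decode zero    []       = []
decode (suc m) (c ∷ cs) = fromℕ∸ m c ∷ map (punchIn (fromℕ∸ m c)) (decode m cs)

encode : ∀ m (π : Vec (Fin m) m) → .(Distinct π) → Vec ℕ m
encode zero    []       _ = []
encode (suc m) (v ∷ vs) d =
  m ∸ toℕ v ∷ encode m (punchOutAll v vs (Distinct-head {x = v} {vs} d))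
                       (punchOutAll-distinct v vs _ (Distinct-tail {x = v} {vs} d))

encode-cong : ∀ {m} {π σ : Vec (Fin m) m} .{dπ dσ} → π ≡ σ → encode m π dπ ≡ encode m σ dσ
encode-cong refl = refl

decode-distinct : ∀ m (c : Vec ℕ m) → Distinct (decode m c)
decode-distinct zero    []       = λ ()
decode-distinct (suc m) (c ∷ cs) =
  Distinct-∷ v∉ (Distinct-map⁺ {xs = decode m cs} (Finₚ.punchIn-injective v _ _) (decode-distinct m cs))
  where
  v = fromℕ∸ m c
  v∉ : ∀ i → lookup (map (punchIn v) (decode m cs)) i ≢ v
  v∉ i = Finₚ.punchInᵢ≢i v _ ∘ trans (sym (lookup-map i (punchIn v) (decode m cs)))

encode-isCode : ∀ m (π : Vec (Fin m) m) .d → IsCode (encode m π d)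
encode-isCode (suc m) (v ∷ vs) d zero    = m∸n≤m m (toℕ v)
encode-isCode (suc m) (v ∷ vs) d (suc i) = encode-isCode m _ _ i

encode-decode : ∀ m (c : Vec ℕ m) → IsCode c → encode m (decode m c) (decode-distinct m c) ≡ c
encode-decode zero    []       _     = refl
encode-decode (suc m) (c ∷ cs) c-ok = cong₂ _∷_
  (trans (cong (m ∸_) (toℕ-fromℕ∸ m c)) (m∸[m∸n]≡n (c-ok zero)))
  (trans (encode-cong (punchOutAll-map-punchIn (fromℕ∸ m c) (decode m cs) _))
         (encode-decode m cs (c-ok ∘ suc)))

decode-encode : ∀ m (π : Vec (Fin m) m) .d → decode m (encode m π d) ≡ π
decode-encode zero    []       _ = refl
decode-encode (suc m) (v ∷ vs) d = begin
  fromℕ∸ m (m ∸ toℕ v) ∷ map (punchIn (fromℕ∸ m (m ∸ toℕ v))) (decode m (encode m ws _))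
    ≡⟨ cong₂ (λ u us → u ∷ map (punchIn u) us) head≡v
             (decode-encode m ws (punchOutAll-distinct v vs _ (Distinct-tail {x = v} {vs} d))) ⟩
  v ∷ map (punchIn v) ws
    ≡⟨ cong (v ∷_) (map-punchIn-punchOutAll v vs _) ⟩
  v ∷ vs ∎
  where
  open ≡-Reasoning
  ws = punchOutAll v vs (Distinct-head {x = v} {vs} d)
  head≡v : fromℕ∸ m (m ∸ toℕ v) ≡ v
  head≡v = Finₚ.toℕ-injective
    (trans (toℕ-fromℕ∸ m (m ∸ toℕ v)) (m∸[m∸n]≡n (Finₚ.toℕ≤pred[n] v)))

fromℕ∸-<-punchIn⇔ : ∀ {m c₀ c₁} → c₁ ≤ m →
  fromℕ∸ (suc m) c₀ Fin.< punchIn (fromℕ∸ (suc m) c₀) (fromℕ∸ m c₁) ⇔ c₁ < c₀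
fromℕ∸-<-punchIn⇔ {m} {c₀} {c₁} c₁≤m =
  ∸-≤-∸⇔ (s≤s c₁≤m) ⇔-∘
  subst₂ (λ a b → v Fin.< punchIn v u ⇔ a ≤ b)
         (toℕ-fromℕ∸ (suc m) c₀) (toℕ-fromℕ∸ m c₁) (<punchIn⇔≤ v u)
  where
  v = fromℕ∸ (suc m) c₀
  u = fromℕ∸ m c₁

decode-ascents : ∀ m (c : Vec ℕ m) → IsCode c → ascents (decode m c) ≡ descentsL (toList c)
decode-ascents zero          []             _    = refl
decode-ascents (suc zero)    (c ∷ [])       _    = refl
decode-ascents (suc (suc m)) (c₀ ∷ c₁ ∷ cs) c-ok = cong₂ _+_
  (cong indicator (<ᵇ-cong (fromℕ∸-<-punchIn⇔ {m} {c₀} {c₁} (c-ok (suc zero)))))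
  (trans (ascents-map (punchIn-<⇔ (fromℕ∸ (suc m) c₀)) (decode (suc m) (c₁ ∷ cs)))
         (decode-ascents (suc m) (c₁ ∷ cs) (c-ok ∘ suc)))

module _ {a} {A : Set a} where

  lookup-∷ʳ-fromℕ : ∀ {n} (xs : Vec A n) x → lookup (xs Vec.∷ʳ x) (fromℕ n) ≡ x
  lookup-∷ʳ-fromℕ []       x = refl
  lookup-∷ʳ-fromℕ (_ ∷ xs) x = lookup-∷ʳ-fromℕ xs x

  lookup-∷ʳ-inject₁ : ∀ {n} (xs : Vec A n) x i → lookup (xs Vec.∷ʳ x) (inject₁ i) ≡ lookup xs i
  lookup-∷ʳ-inject₁ (_ ∷ xs) x zero    = refl
  lookup-∷ʳ-inject₁ (_ ∷ xs) x (suc i) = lookup-∷ʳ-inject₁ xs x i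

  lookup-reverse-opposite : ∀ {n} (xs : Vec A n) i → lookup (reverse xs) (opposite i) ≡ lookup xs i
  lookup-reverse-opposite (x ∷ xs) zero    rewrite reverse-∷ x xs = lookup-∷ʳ-fromℕ (reverse xs) x
  lookup-reverse-opposite (x ∷ xs) (suc i) rewrite reverse-∷ x xs =
    trans (lookup-∷ʳ-inject₁ (reverse xs) x (opposite i)) (lookup-reverse-opposite xs i)

  lookup-reverse : ∀ {n} (xs : Vec A n) i → lookup (reverse xs) i ≡ lookup xs (opposite i)
  lookup-reverse xs i = begin
    lookup (reverse xs) i                      ≡⟨ cong (lookup (reverse xs)) (Finₚ.opposite-involutive i) ⟨
    lookup (reverse xs) (opposite (opposite i)) ≡⟨ lookup-reverse-opposite xs (opposite i) ⟩
    lookup xs (opposite i)                      ∎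
    where open ≡-Reasoning

Distinct-reverse : ∀ {m k} (xs : Vec (Fin m) k) → Distinct xs → Distinct (reverse xs)
Distinct-reverse xs d i j xᵢ≡xⱼ = begin
  i                       ≡⟨ Finₚ.opposite-involutive i ⟨
  opposite (opposite i)   ≡⟨ cong opposite (d _ _ (begin
    lookup xs (opposite i)  ≡⟨ lookup-reverse xs i ⟨
    lookup (reverse xs) i   ≡⟨ xᵢ≡xⱼ ⟩
    lookup (reverse xs) j   ≡⟨ lookup-reverse xs j ⟩
    lookup xs (opposite j)  ∎)) ⟩
  opposite (opposite j)   ≡⟨ Finₚ.opposite-involutive j ⟩
  j                       ∎
  where open ≡-Reasoning

isInvSeq⇒isCode-reverse : ∀ {n} (e : Vec ℕ n) → IsInvSeq e → IsCode (reverse e)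
isInvSeq⇒isCode-reverse {n} e e-inv i = begin
  lookup (reverse e) i   ≡⟨ lookup-reverse e i ⟩
  lookup e (opposite i)  ≤⟨ e-inv (opposite i) ⟩
  toℕ (opposite i)       ≡⟨ Finₚ.opposite-prop i ⟩
  n ∸ suc (toℕ i)        ∎
  where open ≤-Reasoning

isCode⇒isInvSeq-reverse : ∀ {n} (c : Vec ℕ n) → IsCode c → IsInvSeq (reverse c)
isCode⇒isInvSeq-reverse {n} c c-ok i = begin
  lookup (reverse c) i               ≡⟨ lookup-reverse c i ⟩
  lookup c (opposite i)              ≤⟨ c-ok (opposite i) ⟩
  n ∸ suc (toℕ (opposite i))         ≡⟨ Finₚ.opposite-prop (opposite i) ⟨
  toℕ (opposite (opposite i))        ≡⟨ cong toℕ (Finₚ.opposite-involutive i) ⟩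
  toℕ i                              ∎
  where open ≤-Reasoning

isInvSeq? : ∀ {n} (e : Vec ℕ n) → Dec (IsInvSeq e)
isInvSeq? e = Finₚ.all? (λ i → lookup e i ≤? toℕ i)

module _ {n : ℕ} where

  toPerm : Vec ℕ n → Vec (Fin n) n
  toPerm e = reverse (decode n (reverse e))

  toInvSeq : (π : Vec (Fin n) n) → .(Distinct π) → Vec ℕ n
  toInvSeq π d = reverse (encode n (reverse π) (Distinct-reverse π d))

  toPerm-distinct : ∀ e → Distinct (toPerm e)
  toPerm-distinct e = Distinct-reverse (decode n (reverse e)) (decode-distinct n (reverse e))

  toInvSeq-isInvSeq : ∀ π .d → IsInvSeq (toInvSeq π d)
  toInvSeq-isInvSeq π d = isCode⇒isInvSeq-reverse (encode n (reverse π) (Distinct-reverse π d))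
                                                  (encode-isCode n (reverse π) (Distinct-reverse π d))

  descents-toPerm : ∀ e → IsInvSeq e → descents (toPerm e) ≡ ascentsL (toList e)
  descents-toPerm e e-inv = begin
    descents (reverse (decode n (reverse e)))  ≡⟨ descents-reverse (decode n (reverse e)) ⟩
    ascents (decode n (reverse e))
      ≡⟨ decode-ascents n (reverse e) (isInvSeq⇒isCode-reverse e e-inv) ⟩
    descentsL (toList (reverse e))             ≡⟨ descentsL-reverseᵛ e ⟩
    ascentsL (toList e)                        ∎
    where open ≡-Reasoning

  ascents-toInvSeq : ∀ π .d → ascentsL (toList (toInvSeq π d)) ≡ descents π
  ascents-toInvSeq π d = begin
    ascentsL (toList (reverse c))   ≡⟨ ascentsL-reverseᵛ c ⟩
    descentsL (toList c)            ≡⟨ decode-ascents n c (encode-isCode n (reverse π) _) ⟨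
    ascents (decode n c)            ≡⟨ cong ascents (decode-encode n (reverse π) _) ⟩
    ascents (reverse π)             ≡⟨ descents-reverse (reverse π) ⟨
    descents (reverse (reverse π))  ≡⟨ cong descents (reverse-involutive π) ⟩
    descents π                      ∎
    where
    open ≡-Reasoning
    c = encode n (reverse π) (Distinct-reverse π d)

  toPerm-toInvSeq : ∀ π .d → toPerm (toInvSeq π d) ≡ π
  toPerm-toInvSeq π d = begin
    reverse (decode n (reverse (reverse c)))  ≡⟨ cong (reverse ∘ decode n) (reverse-involutive c) ⟩
    reverse (decode n c)                      ≡⟨ cong reverse (decode-encode n (reverse π) _) ⟩
    reverse (reverse π)                       ≡⟨ reverse-involutive π ⟩
    π                                         ∎
    where
    open ≡-Reasoning
    c = encode n (reverse π) (Distinct-reverse π d)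

  toInvSeq-toPerm : ∀ e → IsInvSeq e → toInvSeq (toPerm e) (toPerm-distinct e) ≡ e
  toInvSeq-toPerm e e-inv = begin
    reverse (encode n (reverse (reverse σ)) _)  ≡⟨ cong reverse (encode-cong (reverse-involutive σ)) ⟩
    reverse (encode n σ _)
      ≡⟨ cong reverse (encode-decode n (reverse e) (isInvSeq⇒isCode-reverse e e-inv)) ⟩
    reverse (reverse e)                         ≡⟨ reverse-involutive e ⟩
    e                                           ∎
    where
    open ≡-Reasoning
    σ = decode n (reverse e)

record InvSeqWithAscents (n d : ℕ) : Set where
  constructor mkInvSeq
  field
    seq    : Vec ℕ n
    .isInv : IsInvSeq seq
    .nAsc  : ascentsL (toList seq) ≡ d

InvSeqWithAscents-≡ : ∀ {n d} {x y : InvSeqWithAscents n d} →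
                      InvSeqWithAscents.seq x ≡ InvSeqWithAscents.seq y → x ≡ y
InvSeqWithAscents-≡ refl = refl

PermWithDescents-≡ : ∀ {n d} {x y : PermWithDescents n d} →
                     PermWithDescents.perm x ≡ PermWithDescents.perm y → x ≡ y
PermWithDescents-≡ refl = refl

invSeqWithAscents↔permWithDescents : ∀ n d → InvSeqWithAscents n d ↔ PermWithDescents n d
invSeqWithAscents↔permWithDescents n d = mk↔ₛ′ to from to∘from from∘to
  where
  to : InvSeqWithAscents n d → PermWithDescents n d
  to (mkInvSeq e e-inv asc) =
    mkPerm (toPerm e) (toPerm-distinct e) (trans (descents-toPerm e e-inv) asc)

  from : PermWithDescents n d → InvSeqWithAscents n d
  from (mkPerm π π-dist des) =
    mkInvSeq (toInvSeq π π-dist) (toInvSeq-isInvSeq π π-dist) (trans (ascents-toInvSeq π π-dist) des)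

  to∘from : ∀ y → to (from y) ≡ y
  to∘from (mkPerm π π-dist _) = PermWithDescents-≡ (toPerm-toInvSeq π π-dist)

  from∘to : ∀ x → from (to x) ≡ x
  from∘to (mkInvSeq e e-inv _) = InvSeqWithAscents-≡ (toInvSeq-toPerm e (recompute (isInvSeq? e) e-inv))

RisesInZeroPrefix : ∀ {n} → Vec ℕ n → Set
RisesInZeroPrefix e =
  ∀ {i j} → i Fin.< j → lookup e i < lookup e j → ∀ {k} → k Fin.≤ i → lookup e k ≡ 0

Antitone : ∀ {n} → Vec ℕ n → Set
Antitone e = ∀ {i j} → i Fin.≤ j → lookup e j ≤ lookup e i

risesInZeroPrefix-[] : RisesInZeroPrefix []
risesInZeroPrefix-[] {()}

risesInZeroPrefix-∷0 : ∀ {n} {e : Vec ℕ n} → RisesInZeroPrefix e → RisesInZeroPrefix (0 ∷ e)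
risesInZeroPrefix-∷0 r {zero}  {_}     _         _     {zero}  _         = refl
risesInZeroPrefix-∷0 r {suc i} {_}     _         _     {zero}  _         = refl
risesInZeroPrefix-∷0 r {suc i} {suc j} (s<s i<j) eᵢ<eⱼ {suc k} (s≤s k≤i) = r i<j eᵢ<eⱼ k≤i

antitone⇒risesInZeroPrefix : ∀ {n} {e : Vec ℕ n} → Antitone e → RisesInZeroPrefix e
antitone⇒risesInZeroPrefix anti i<j eᵢ<eⱼ = ⊥-elim (<⇒≱ eᵢ<eⱼ (anti (<⇒≤ i<j)))

<ᵇ-indicator≡0 : ∀ m n → indicator (m <ᵇ n) ≡ 0 → n ≤ m
<ᵇ-indicator≡0 m n h with m <ᵇ n | <ᵇ-reflects-< m n
<ᵇ-indicator≡0 m n () | true  | _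
... | false | ofⁿ m≮n = ≮⇒≥ m≮n

ascentsL≡0⇒antitone : ∀ {n} (e : Vec ℕ n) → ascentsL (toList e) ≡ 0 → Antitone e
ascentsL≡0⇒antitone (x ∷ [])    _ {zero}  {zero}  _         = ≤-refl
ascentsL≡0⇒antitone (x ∷ y ∷ e) _ {zero}  {zero}  _         = ≤-refl
ascentsL≡0⇒antitone (x ∷ y ∷ e) h {zero}  {suc j} _         =
  ≤-trans (ascentsL≡0⇒antitone (y ∷ e) (m+n≡0⇒n≡0 _ h) {zero} {j} z≤n)
          (<ᵇ-indicator≡0 x y (m+n≡0⇒m≡0 _ h))
ascentsL≡0⇒antitone (x ∷ y ∷ e) h {suc i} {suc j} (s≤s i≤j) =
  ascentsL≡0⇒antitone (y ∷ e) (m+n≡0⇒n≡0 _ h) i≤j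

ascentsL≤1⇒risesInZeroPrefix : ∀ {n} (e : Vec ℕ n) →
                               ascentsL (toList (0 ∷ e)) ≤ 1 → RisesInZeroPrefix (0 ∷ e)
ascentsL≤1⇒risesInZeroPrefix []          _       = risesInZeroPrefix-∷0 risesInZeroPrefix-[]
ascentsL≤1⇒risesInZeroPrefix (zero ∷ e)  h       =
  risesInZeroPrefix-∷0 (ascentsL≤1⇒risesInZeroPrefix e h)
ascentsL≤1⇒risesInZeroPrefix (suc y ∷ e) (s≤s h) = risesInZeroPrefix-∷0
  (antitone⇒risesInZeroPrefix {e = suc y ∷ e} (ascentsL≡0⇒antitone (suc y ∷ e) (n≤0⇒n≡0 h)))

invSeq-ascentsL≤1⇒risesInZeroPrefix : ∀ {n} (e : Vec ℕ n) → IsInvSeq e →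
                                      ascentsL (toList e) ≤ 1 → RisesInZeroPrefix e
invSeq-ascentsL≤1⇒risesInZeroPrefix []      _     _ = risesInZeroPrefix-[]
invSeq-ascentsL≤1⇒risesInZeroPrefix (x ∷ e) e-inv h with n≤0⇒n≡0 (e-inv zero)
... | refl = ascentsL≤1⇒risesInZeroPrefix e h

-- In an occurrence α of p, the rise at (α a, α b) forces e_{α c} = 0, which cannot exceed e_{α d}.
risesInZeroPrefix⇒avoids : ∀ {n m} (e : Vec ℕ n) (p : Vec ℕ m) → RisesInZeroPrefix e →
  ∀ a b c d → a Fin.< b → c Fin.≤ a → lookup p a < lookup p b → lookup p d < lookup p c →
  Avoids e p
risesInZeroPrefix⇒avoids e p r a b c d a<b c≤a pₐ<p_b p_d<p_c (α , α-mono , α-iso) =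
  n≮0 (subst (lookup e (α d) <_) e[αc]≡0 (Equivalence.from (proj₁ (α-iso d c)) p_d<p_c))
  where
  αc≤αa : α c Fin.≤ α a
  αc≤αa with m≤n⇒m<n∨m≡n c≤a
  ... | inj₁ c<a = <⇒≤ (α-mono c a c<a)
  ... | inj₂ c≡a = ≤-reflexive (cong (toℕ ∘ α) (Finₚ.toℕ-injective c≡a))
  e[αc]≡0 : lookup e (α c) ≡ 0
  e[αc]≡0 = r (α-mono a b a<b) (Equivalence.from (proj₁ (α-iso a b)) pₐ<p_b) αc≤αa

risesInZeroPrefix⇒avoids-120-201-1010 : ∀ {n} (e : Vec ℕ n) → RisesInZeroPrefix e →
                                        Avoids e p120 × Avoids e p201 × Avoids e p1010
risesInZeroPrefix⇒avoids-120-201-1010 e r =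
  risesInZeroPrefix⇒avoids e p120 r (# 0) (# 1) (# 0) (# 2) z<s       z≤n (s<s z<s) z<s ,
  risesInZeroPrefix⇒avoids e p201 r (# 1) (# 2) (# 0) (# 1) (s<s z<s) z≤n z<s z<s ,
  risesInZeroPrefix⇒avoids e p1010 r (# 1) (# 2) (# 0) (# 1) (s<s z<s) z≤n z<s z<s

popInvSeq↔invSeqWithAscents : ∀ {n d} → d ≤ 1 → PopInvSeq n (suc d) ↔ InvSeqWithAscents n d
popInvSeq↔invSeqWithAscents {n} {d} d≤1 = mk↔ₛ′ forget remember (λ _ → refl) (λ _ → refl)
  where
  avoids : ∀ e → IsInvSeq e → ascentsL (toList e) ≡ d →
           Avoids e p120 × Avoids e p201 × Avoids e p1010
  avoids e e-inv asc = risesInZeroPrefix⇒avoids-120-201-1010 e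
    (invSeq-ascentsL≤1⇒risesInZeroPrefix e e-inv (subst (_≤ 1) (sym asc) d≤1))

  forget : PopInvSeq n (suc d) → InvSeqWithAscents n d
  forget (mkPopInvSeq e e-inv _ _ _ layers≡) = mkInvSeq e e-inv (suc-injective layers≡)

  remember : InvSeqWithAscents n d → PopInvSeq n (suc d)
  remember (mkInvSeq e e-inv asc) = mkPopInvSeq e e-inv
    (proj₁ (avoids e e-inv asc))
    (proj₁ (proj₂ (avoids e e-inv asc)))
    (proj₂ (proj₂ (avoids e e-inv asc)))
    (cong suc asc)

-- The hypothesis 1 ≤ n is unused: for n = 0 both sides are singletons (k = 1) or empty (k = 2).
mainTheorem6 : (n k : ℕ) → 1 ≤ n → (k ≡ 1 ⊎ k ≡ 2) →
    PopInvSeq n k ↔ PermWithDescents n (k ∸ 1)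
mainTheorem6 n _ _ (inj₁ refl) =
  invSeqWithAscents↔permWithDescents n 0 ↔-∘ popInvSeq↔invSeqWithAscents z≤n
mainTheorem6 n _ _ (inj₂ refl) =
  invSeqWithAscents↔permWithDescents n 1 ↔-∘ popInvSeq↔invSeqWithAscents (s≤s z≤n)
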